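{- Let $H$ be a finite simple graph with $\delta(H)\ge1$ and let $\{H=\mathcal H_1,\dots,\mathcal H_s\}$ be a $d$-sequence of $H$ with $Z=\min\{z_i(H): 2\le i\le s\}\le 0$. Let $G=H+K_{1,k}$. If $k\ge d_H-Z$, then $str(G)=|V(G)|+1$.
   Context: $K_{1,k}$ is the star with $k$ leaves; $+$ is disjoint union, $mK_1$ is $m$ isolated vertices, $K_r$ the complete graph; empty sums are $0$. For a graph $G$ of order $p$, a numbering is a bijection $f:V(G)\to\{1,\dots,p\}$; $str_f(G)=\max\{f(u)+f(v): uv\in E(G)\}$ and $str(G)=\min\{str_f(G)\}$ over numberings. $d$-sequence of $H$: set $\mathcal H_1=H_1=H$, $m_1=0$. For $i\ge1$, if $\mathcal H_i$ is neither of the form $mK_1$ ($m\ge1$) nor $mK_1+K_r$ ($m\ge0$, $r\ge2$), write $\mathcal H_i=m_iK_1+H_i$ where $m_i\ge0$ is the number of isolated vertices of $\mathcal H_i$ and $H_i$ has no isolated vertices; choose any vertex $u_i$ of $H_i$, let $d_i$ be its degree in $H_i$, and obtain $\mathcal H_{i+1}$ from $\mathcal H_i$ by deleting its isolated vertices, $u_i$ and all neighbors of $u_i$. Stop at the first $s$ with $\mathcal H_s=m_sK_1$, $m_s\ge1$ (set $d_s=0$) or $\mathcal H_s=m_sK_1+K_r$, $m_s\ge0$, $r\ge2$ (set $d_s=r-1$). Write $d_H=d_1$, $y_j(H)=m_j+1-d_j$, $z_i(H)=\sum_{j=2}^i y_j(H)$. -}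

module Defs where

open import Data.Nat using (ℕ; zero; suc; _+_; _∸_; _⊔_; _≤_)
open import Data.Bool using (Bool; true; false; _∧_; not; if_then_else_)
open import Data.Fin using (Fin; zero; suc; toℕ; splitAt; _≟_)
open import Data.Sum using (_⊎_; inj₁; inj₂)
open import Data.Product using (_×_; _,_; ∃; ∃-syntax; Σ)
open import Data.List using (List; []; _∷_; map; drop)
open import Data.Maybe using (Maybe; just; nothing)
open import Data.Integer as ℤ using (ℤ; +_; _⊓_)
open import Relation.Nullary using (¬_)
open import Relation.Nullary.Decidable using (⌊_⌋)
open import Relation.Binary.PropositionalEquality using (_≡_; _≢_; refl)
open import Function.Bundles using (_⤖_; Bijection)

record Graph (n : ℕ) : Set where
  field
    adj    : Fin n → Fin n → Bool
    sym    : ∀ u v → adj u v ≡ adj v u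
    irrefl : ∀ u → adj u u ≡ false
open Graph public

MinDegPos : ∀ {n} → Graph n → Set
MinDegPos {n} H = ∀ (v : Fin n) → ∃[ w ] adj H v w ≡ true

starAdj : ∀ {k} → Fin (suc k) → Fin (suc k) → Bool
starAdj zero    zero    = false
starAdj zero    (suc _) = true
starAdj (suc _) zero    = true
starAdj (suc _) (suc _) = false

starSym : ∀ {k} (u v : Fin (suc k)) → starAdj u v ≡ starAdj v u
starSym zero    zero    = refl
starSym zero    (suc _) = refl
starSym (suc _) zero    = refl
starSym (suc _) (suc _) = refl

starIrr : ∀ {k} (u : Fin (suc k)) → starAdj u u ≡ false
starIrr zero    = refl
starIrr (suc _) = refl

star : (k : ℕ) → Graph (suc k)
star k = record { adj = starAdj ; sym = starSym ; irrefl = starIrr }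

-- Disjoint union G + H on Fin (m + n) (first m vertices from G).

sumAdj : ∀ {m n} → Graph m → Graph n → (Fin m ⊎ Fin n) → (Fin m ⊎ Fin n) → Bool
sumAdj G H (inj₁ x) (inj₁ y) = adj G x y
sumAdj G H (inj₁ x) (inj₂ y) = false
sumAdj G H (inj₂ x) (inj₁ y) = false
sumAdj G H (inj₂ x) (inj₂ y) = adj H x y

sumSym : ∀ {m n} (G : Graph m) (H : Graph n) a b → sumAdj G H a b ≡ sumAdj G H b a
sumSym G H (inj₁ x) (inj₁ y) = sym G x y
sumSym G H (inj₁ x) (inj₂ y) = refl
sumSym G H (inj₂ x) (inj₁ y) = refl
sumSym G H (inj₂ x) (inj₂ y) = sym H x y

sumIrr : ∀ {m n} (G : Graph m) (H : Graph n) a → sumAdj G H a a ≡ false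
sumIrr G H (inj₁ x) = irrefl G x
sumIrr G H (inj₂ x) = irrefl H x

_⊕_ : ∀ {m n} → Graph m → Graph n → Graph (m + n)
_⊕_ {m} G H = record
  { adj    = λ u v → sumAdj G H (splitAt m u) (splitAt m v)
  ; sym    = λ u v → sumSym G H (splitAt m u) (splitAt m v)
  ; irrefl = λ u → sumIrr G H (splitAt m u) }

-- Strength.  A numbering is a bijection f : V → {1..p}; we encode it as a
-- bijection Fin p ⤖ Fin p with label v = 1 + toℕ (f v).

Numbering : ℕ → Set
Numbering p = Fin p ⤖ Fin p

label : ∀ {p} → Numbering p → Fin p → ℕ
label f v = suc (toℕ (Bijection.to f v))

maxF : ∀ {n} → (Fin n → ℕ) → ℕ
maxF {zero}  g = 0
maxF {suc n} g = g zero ⊔ maxF (λ i → g (suc i))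

strF : ∀ {p} → Graph p → Numbering p → ℕ
strF G f = maxF (λ u → maxF (λ v → if adj G u v then label f u + label f v else 0))

StrengthIs : ∀ {p} → Graph p → ℕ → Set
StrengthIs {p} G s = (∃[ f ] strF G f ≡ s) × (∀ (f : Numbering p) → s ≤ strF G f)

-- Vertex sets as Boolean predicates; induced subgraphs H[S].

countF : ∀ {n} → (Fin n → Bool) → ℕ
countF {zero}  P = 0
countF {suc n} P = (if P zero then 1 else 0) + countF (λ i → P (suc i))

anyF : ∀ {n} → (Fin n → Bool) → Bool
anyF {zero}  P = false
anyF {suc n} P = if P zero then true else anyF (λ i → P (suc i))

VSet : ℕ → Set
VSet n = Fin n → Bool

module _ {n : ℕ} (H : Graph n) where

  hasNbrIn : VSet n → Fin n → Bool
  hasNbrIn S v = anyF (λ w → S w ∧ adj H v w)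

  isoIn : VSet n → VSet n
  isoIn S v = S v ∧ not (hasNbrIn S v)

  nonIsoIn : VSet n → VSet n
  nonIsoIn S v = S v ∧ hasNbrIn S v

  degIn : VSet n → Fin n → ℕ
  degIn S u = countF (λ w → S w ∧ adj H u w)

  nextSet : VSet n → Fin n → VSet n
  nextSet S u v = nonIsoIn S v ∧ not ⌊ v ≟ u ⌋ ∧ not (adj H u v)

  IsEmptyGraph : VSet n → Set
  IsEmptyGraph S = (∃[ v ] S v ≡ true)
                 × (∀ v w → S v ≡ true → S w ≡ true → adj H v w ≡ false)

  IsIsoPlusClique : VSet n → Set
  IsIsoPlusClique S = (2 ≤ countF (nonIsoIn S))
                    × (∀ v w → nonIsoIn S v ≡ true → nonIsoIn S w ≡ true → v ≢ w → adj H v w ≡ true)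

  Terminal : VSet n → Set
  Terminal S = IsEmptyGraph S ⊎ IsIsoPlusClique S

  data DSeq : VSet n → Set where
    endEmpty  : ∀ {S} → IsEmptyGraph S → DSeq S
    endClique : ∀ {S} → IsIsoPlusClique S → DSeq S
    step      : ∀ {S} (u : Fin n) → nonIsoIn S u ≡ true → ¬ Terminal S
              → DSeq (nextSet S u) → DSeq S

  params : ∀ {S} → DSeq S → List (ℕ × ℕ)
  params {S} (endEmpty _)   = (countF S , 0) ∷ []
  params {S} (endClique _)  = (countF (isoIn S) , countF (nonIsoIn S) ∸ 1) ∷ []
  params {S} (step u _ _ D) = (countF (isoIn S) , degIn S u) ∷ params D

  dFirst : ∀ {S} → DSeq S → ℕ
  dFirst (endEmpty _)      = 0
  dFirst {S} (endClique _) = countF (nonIsoIn S) ∸ 1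
  dFirst {S} (step u _ _ _) = degIn S u

yOf : ℕ × ℕ → ℤ
yOf (m , d) = (+ m ℤ.+ + 1) ℤ.- + d

prefixSums : ℤ → List ℤ → List ℤ
prefixSums acc []       = []
prefixSums acc (y ∷ ys) = (acc ℤ.+ y) ∷ prefixSums (acc ℤ.+ y) ys

minList : List ℤ → Maybe ℤ
minList []       = nothing
minList (x ∷ xs) with minList xs
... | nothing = just x
... | just m  = just (x ⊓ m)

zList : ∀ {n} (H : Graph n) {S} → DSeq H S → List ℤ
zList H D = prefixSums (+ 0) (map yOf (drop 1 (params H D)))

-- Z = min { z_i : 2 ≤ i ≤ s }  (nothing if s = 1)
Zmin : ∀ {n} (H : Graph n) {S} → DSeq H S → Maybe ℤ
Zmin H D = minList (zList H D)

fullSet : ∀ {n} → VSet n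
fullSet _ = true

{-# OPTIONS --safe #-}
-- Since H + K_{1,k} has no isolated vertex, the vertex numbered p = |V(G)| has a neighbour, so
-- str(G) ≥ p + 1.  For the converse every vertex gets a slot, low t or high t: along the
-- d-sequence the isolated vertices of ℋ_i get high (i − 1), u_i gets high i and its neighbours
-- low i, while the centre of the star gets low 0 and its k leaves high 0.  Every edge is then
-- low–low or joins a low slot to a later-or-equal high one.  Numbering the low slots first, by
-- increasing time, and then the high slots, by decreasing time, gives every edge label sum at most
-- p + 1 provided that for each time T the low slots up to T outnumber the high slots before T by
-- at most one.  The leaves provide k high slots in advance and step i spends d_i and returns
-- m_i + 1, so this holds as long as the budget k + y_1 + z_i stays positive, which is what
-- Z ≤ 0 and k ≥ d_H − Z guarantee.
module Submission where

open import Defs renaming (sym to adj-sym)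

module Strength where

  open import Data.Nat using (ℕ; zero; suc; _+_; _*_; _∸_; _≤_; _<_; z≤n; s≤s)
  open import Data.Nat.Properties hiding (_≟_)
  open import Data.Bool using (Bool; true; false; _∧_; _∨_; if_then_else_)
  open import Data.Bool.Properties using (∧-conicalˡ; ∧-zeroʳ; ∨-identityʳ)
  open import Data.Fin using (Fin; zero; suc; toℕ; fromℕ; fromℕ<; splitAt; punchOut; _≟_; _↑ˡ_; _↑ʳ_)
  import Data.Fin.Properties as Fin
  open import Data.Product using (_×_; _,_; ∃-syntax; proj₁; proj₂)
  open import Data.Sum using (_⊎_; inj₁; inj₂; [_,_]′)
  open import Data.Empty using (⊥; ⊥-elim)
  open import Data.Unit using (⊤; tt)
  open import Data.List using (List; []; _∷_)
  open import Relation.Nullary using (¬_; Dec; yes; no)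
  open import Relation.Nullary.Decidable using (⌊_⌋)
  open import Relation.Binary using (tri<; tri≈; tri>)
  open import Relation.Binary.PropositionalEquality
  open import Function.Definitions using (Injective; Surjective)
  open import Function using (_∘_)
  open import Function.Bundles using (Bijection; mk⤖)
  open import Algebra.Properties.CommutativeSemigroup +-commutativeSemigroup using (interchange)

  ⌊⌋-true : ∀ {P : Set} (d : Dec P) → P → ⌊ d ⌋ ≡ true
  ⌊⌋-true (yes _) _ = refl
  ⌊⌋-true (no ¬p) p = ⊥-elim (¬p p)

  ⌊⌋-false : ∀ {P : Set} (d : Dec P) → ¬ P → ⌊ d ⌋ ≡ false
  ⌊⌋-false (yes p) ¬p = ⊥-elim (¬p p)
  ⌊⌋-false (no _) _ = refl

  ⌊⌋-sound : ∀ {P : Set} (d : Dec P) → ⌊ d ⌋ ≡ true → P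
  ⌊⌋-sound (yes p) _ = p

  true≢false : true ≢ false
  true≢false ()

  indicator : Bool → ℕ
  indicator b = if b then 1 else 0

  indicator≤1 : ∀ b → indicator b ≤ 1
  indicator≤1 true = ≤-refl
  indicator≤1 false = z≤n

  indicator-+-≤-by : ∀ {a b c x y z} → a ≡ x → b ≡ y → c ≡ z
    → indicator x + indicator y ≤ indicator z → indicator a + indicator b ≤ indicator c
  indicator-+-≤-by refl refl refl h = h

  indicator-≤-+-by : ∀ {a b c x y z} → a ≡ x → b ≡ y → c ≡ z
    → indicator x ≤ indicator y + indicator z → indicator a ≤ indicator b + indicator c
  indicator-≤-+-by refl refl refl h = h

  countF-cong : ∀ {n} {P Q : Fin n → Bool} → (∀ i → P i ≡ Q i) → countF P ≡ countF Q
  countF-cong {zero} e = refl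
  countF-cong {suc n} {P} {Q} e =
    cong₂ (λ b c → indicator b + c) (e zero) (countF-cong (λ i → e (suc i)))

  countF-mono : ∀ {n} {P Q : Fin n → Bool} → (∀ i → P i ≡ true → Q i ≡ true) → countF P ≤ countF Q
  countF-mono {zero} h = z≤n
  countF-mono {suc n} {P} {Q} h with P zero in eP | Q zero in eQ
  ... | true  | true  = s≤s (countF-mono (λ i → h (suc i)))
  ... | true  | false with () ← trans (sym (h zero eP)) eQ
  ... | false | true  = m≤n⇒m≤1+n (countF-mono (λ i → h (suc i)))
  ... | false | false = countF-mono (λ i → h (suc i))

  countF-none : ∀ {n} {P : Fin n → Bool} → (∀ i → P i ≡ false) → countF P ≡ 0
  countF-none {zero} h = refl
  countF-none {suc n} h rewrite h zero = countF-none (λ i → h (suc i))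

  countF-all : ∀ {n} {P : Fin n → Bool} → (∀ i → P i ≡ true) → countF P ≡ n
  countF-all {zero} h = refl
  countF-all {suc n} h rewrite h zero = cong suc (countF-all (λ i → h (suc i)))

  countF-pos : ∀ {n} (P : Fin n → Bool) i → P i ≡ true → 1 ≤ countF P
  countF-pos P zero e rewrite e = s≤s z≤n
  countF-pos P (suc i) e = ≤-trans (countF-pos _ i e) (m≤n+m _ (indicator (P zero)))

  countF-witness : ∀ {n} (P : Fin n → Bool) → 1 ≤ countF P → ∃[ i ] P i ≡ true
  countF-witness {suc n} P h with P zero in eP
  ... | true  = zero , eP
  ... | false with i , e ← countF-witness (λ i → P (suc i)) h = suc i , e

  countF-+-≤ : ∀ {n} {P Q R : Fin n → Bool} → (∀ i → indicator (P i) + indicator (Q i) ≤ indicator (R i))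
    → countF P + countF Q ≤ countF R
  countF-+-≤ {zero} h = z≤n
  countF-+-≤ {suc n} {P} {Q} {R} h = begin
    p₀ + ps + (q₀ + qs)  ≡⟨ interchange p₀ ps q₀ qs ⟩
    p₀ + q₀ + (ps + qs)  ≤⟨ +-mono-≤ (h zero) (countF-+-≤ (λ i → h (suc i))) ⟩
    countF R             ∎
    where
    open ≤-Reasoning
    p₀ = indicator (P zero)
    q₀ = indicator (Q zero)
    ps = countF (λ i → P (suc i))
    qs = countF (λ i → Q (suc i))

  countF-≤-+ : ∀ {n} {P Q R : Fin n → Bool} → (∀ i → indicator (R i) ≤ indicator (P i) + indicator (Q i))
    → countF R ≤ countF P + countF Q
  countF-≤-+ {zero} h = z≤n
  countF-≤-+ {suc n} {P} {Q} {R} h = begin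
    countF R             ≤⟨ +-mono-≤ (h zero) (countF-≤-+ (λ i → h (suc i))) ⟩
    p₀ + q₀ + (ps + qs)  ≡⟨ interchange p₀ q₀ ps qs ⟩
    p₀ + ps + (q₀ + qs)  ∎
    where
    open ≤-Reasoning
    p₀ = indicator (P zero)
    q₀ = indicator (Q zero)
    ps = countF (λ i → P (suc i))
    qs = countF (λ i → Q (suc i))

  countF-< : ∀ {n} {P Q : Fin n → Bool} j → (∀ i → P i ≡ true → Q i ≡ true)
    → P j ≡ false → Q j ≡ true → countF P < countF Q
  countF-< {P = P} {Q} j P⊆Q Pj Qj = begin-strict
    countF P                                 <⟨ m<m+n (countF P) (countF-pos _ j (⌊⌋-true (j ≟ j) refl)) ⟩
    countF P + countF (λ i → ⌊ i ≟ j ⌋)      ≤⟨ countF-+-≤ pointwise ⟩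
    countF Q                                 ∎
    where
    open ≤-Reasoning
    pointwise : ∀ i → indicator (P i) + indicator ⌊ i ≟ j ⌋ ≤ indicator (Q i)
    pointwise i with i ≟ j
    ... | yes refl rewrite Pj | Qj = ≤-refl
    ... | no _ with P i in Pi
    ... | true  rewrite P⊆Q i Pi = ≤-refl
    ... | false = z≤n

  countF-splitAt : ∀ m {n} (P : Fin (m + n) → Bool) →
    countF P ≡ countF (λ i → P (i ↑ˡ n)) + countF (λ j → P (m ↑ʳ j))
  countF-splitAt zero P = refl
  countF-splitAt (suc m) P =
    trans (cong (indicator (P zero) +_) (countF-splitAt m (λ i → P (suc i))))
          (sym (+-assoc (indicator (P zero)) _ _))

  -- Numberings induced by a key

  injective⇒surjective : ∀ {p} {f : Fin p → Fin p} → Injective _≡_ _≡_ f → Surjective _≡_ _≡_ f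
  injective⇒surjective {suc q} {f} inj y with Fin.any? (λ x → f x ≟ y)
  ... | yes (x , fx≡y) = x , λ { refl → fx≡y }
  ... | no ∄x = ⊥-elim (<-irrefl refl (Fin.injective⇒≤ g-injective))
    where
    g : Fin (suc q) → Fin q
    g x = punchOut (λ y≡fx → ∄x (x , sym y≡fx))
    g-injective : Injective _≡_ _≡_ g
    g-injective {a} {b} = inj ∘ Fin.punchOut-injective (λ e → ∄x (a , sym e)) (λ e → ∄x (b , sym e))

  module ByKey {p : ℕ} (κ : Fin p → ℕ) where

    -- κ refined to an injective key by breaking ties with the vertex index
    K : Fin p → ℕ
    K v = κ v * p + toℕ v

    K-mono : ∀ {a b} → κ a < κ b → K a < K b
    K-mono {a} {b} κa<κb = begin-strict
      κ a * p + toℕ a  <⟨ +-monoʳ-< (κ a * p) (Fin.toℕ<n a) ⟩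
      κ a * p + p      ≡⟨ +-comm (κ a * p) p ⟩
      suc (κ a) * p    ≤⟨ *-monoˡ-≤ p κa<κb ⟩
      κ b * p          ≤⟨ m≤m+n (κ b * p) (toℕ b) ⟩
      K b              ∎
      where open ≤-Reasoning

    K-injective : ∀ {a b} → K a ≡ K b → a ≡ b
    K-injective {a} {b} Ka≡Kb with <-cmp (κ a) (κ b)
    ... | tri< lt _ _ = ⊥-elim (<-irrefl Ka≡Kb (K-mono lt))
    ... | tri> _ _ gt = ⊥-elim (<-irrefl (sym Ka≡Kb) (K-mono gt))
    ... | tri≈ _ eq _ = Fin.toℕ-injective (+-cancelˡ-≡ (κ a * p) _ _
                          (trans Ka≡Kb (cong (λ x → x * p + toℕ b) (sym eq))))

    position : Fin p → ℕ
    position v = countF (λ w → ⌊ K w <? K v ⌋)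

    position<p : ∀ v → position v < p
    position<p v = ≤-trans
      (countF-< v (λ _ _ → refl) (⌊⌋-false (K v <? K v) (<-irrefl refl)) refl)
      (≤-reflexive (countF-all (λ _ → refl)))

    position-mono : ∀ {a b} → K a < K b → position a < position b
    position-mono {a} {b} Ka<Kb = countF-< a
      (λ w e → ⌊⌋-true (K w <? K b) (<-trans (⌊⌋-sound (K w <? K a) e) Ka<Kb))
      (⌊⌋-false (K a <? K a) (<-irrefl refl))
      (⌊⌋-true (K a <? K b) Ka<Kb)

    rank : Fin p → Fin p
    rank v = fromℕ< (position<p v)

    position-injective : ∀ {a b} → position a ≡ position b → a ≡ b
    position-injective {a} {b} pa≡pb with <-cmp (K a) (K b)
    ... | tri< lt _ _ = ⊥-elim (<-irrefl pa≡pb (position-mono lt))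
    ... | tri> _ _ gt = ⊥-elim (<-irrefl (sym pa≡pb) (position-mono gt))
    ... | tri≈ _ eq _ = K-injective eq

    toℕ-rank : ∀ v → toℕ (rank v) ≡ position v
    toℕ-rank v = Fin.toℕ-fromℕ< (position<p v)

    rank-injective : Injective _≡_ _≡_ rank
    rank-injective {a} {b} ra≡rb =
      position-injective (trans (sym (toℕ-rank a)) (trans (cong toℕ ra≡rb) (toℕ-rank b)))

    numbering : Numbering p
    numbering = mk⤖ (rank-injective , injective⇒surjective rank-injective)

    label≤atOrBelow : ∀ v → label numbering v ≤ countF (λ w → ⌊ κ w ≤? κ v ⌋)
    label≤atOrBelow v = subst (_≤ countF (λ w → ⌊ κ w ≤? κ v ⌋)) (cong suc (sym (toℕ-rank v)))
      (countF-< v below⇒atOrBelow (⌊⌋-false (K v <? K v) (<-irrefl refl)) (⌊⌋-true (κ v ≤? κ v) ≤-refl))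
      where
      below⇒atOrBelow : ∀ w → ⌊ K w <? K v ⌋ ≡ true → ⌊ κ w ≤? κ v ⌋ ≡ true
      below⇒atOrBelow w e =
        ⌊⌋-true (κ w ≤? κ v) (≮⇒≥ (λ κv<κw → <⇒≯ (⌊⌋-sound (K w <? K v) e) (K-mono κv<κw)))

    label+above≤p : ∀ v → label numbering v + countF (λ w → ⌊ κ v <? κ w ⌋) ≤ p
    label+above≤p v = begin
      label numbering v + above           ≡⟨ cong (λ x → suc x + above) (toℕ-rank v) ⟩
      suc (position v) + above            ≤⟨ +-monoˡ-≤ above (countF-< v
                                               (λ w e → ⌊⌋-true (K w ≤? K v) (<⇒≤ (⌊⌋-sound (K w <? K v) e)))
                                               (⌊⌋-false (K v <? K v) (<-irrefl refl))
                                               (⌊⌋-true (K v ≤? K v) ≤-refl)) ⟩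
      countF (λ w → ⌊ K w ≤? K v ⌋) + above  ≤⟨ countF-+-≤ disjoint ⟩
      countF {p} (λ _ → true)             ≡⟨ countF-all (λ _ → refl) ⟩
      p                                   ∎
      where
      open ≤-Reasoning
      above = countF (λ w → ⌊ κ v <? κ w ⌋)
      disjoint : ∀ w → indicator ⌊ K w ≤? K v ⌋ + indicator ⌊ κ v <? κ w ⌋ ≤ 1
      disjoint w with κ v <? κ w
      ... | yes κv<κw rewrite ⌊⌋-false (K w ≤? K v) (<⇒≱ (K-mono κv<κw)) = ≤-refl
      ... | no _ rewrite +-identityʳ (indicator ⌊ K w ≤? K v ⌋) = indicator≤1 _

  maxF-lub : ∀ {n} {g : Fin n → ℕ} {b} → (∀ i → g i ≤ b) → maxF g ≤ b
  maxF-lub {zero} h = z≤n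
  maxF-lub {suc n} h = ⊔-lub (h zero) (maxF-lub (λ i → h (suc i)))

  ≤-maxF : ∀ {n} (g : Fin n → ℕ) i → g i ≤ maxF g
  ≤-maxF g zero = m≤m⊔n _ _
  ≤-maxF g (suc i) = ≤-trans (≤-maxF (λ j → g (suc j)) i) (m≤n⊔m (g zero) _)

  strF-lub : ∀ {p} (G : Graph p) (f : Numbering p) {b}
    → (∀ u v → adj G u v ≡ true → label f u + label f v ≤ b) → strF G f ≤ b
  strF-lub G f {b} h = maxF-lub λ u → maxF-lub λ v → edge-term u v
    where
    edge-term : ∀ u v → (if adj G u v then label f u + label f v else 0) ≤ b
    edge-term u v with adj G u v in e
    ... | true  = h u v e
    ... | false = z≤n

  edge≤strF : ∀ {p} (G : Graph p) (f : Numbering p) {u v}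
    → adj G u v ≡ true → label f u + label f v ≤ strF G f
  edge≤strF G f {u} {v} e = ≤-trans (≤-reflexive edge-term) (≤-trans (≤-maxF _ v) (≤-maxF _ u))
    where
    edge-term : label f u + label f v ≡ (if adj G u v then label f u + label f v else 0)
    edge-term rewrite e = refl

  order+1≤strF : ∀ {p} (G : Graph p) → MinDegPos G → Fin p → (f : Numbering p) → p + 1 ≤ strF G f
  order+1≤strF {suc q} G δ≥1 _ f = begin
    suc q + 1            ≤⟨ +-monoʳ-≤ (suc q) (s≤s z≤n) ⟩
    suc q + label f w    ≡⟨ cong (_+ label f w) (sym label-x) ⟩
    label f x + label f w  ≤⟨ edge≤strF G f (proj₂ (δ≥1 x)) ⟩
    strF G f             ∎
    where
    open ≤-Reasoning
    x = proj₁ (Bijection.surjective f (fromℕ q))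
    w = proj₁ (δ≥1 x)
    label-x : label f x ≡ suc q
    label-x = trans (cong (suc ∘ toℕ) (proj₂ (Bijection.surjective f (fromℕ q)) refl))
                    (cong suc (Fin.toℕ-fromℕ q))

  strengthIs-order+1 : ∀ {p} (G : Graph p) → MinDegPos G → Fin p
    → (∃[ f ] strF G f ≤ p + 1) → StrengthIs G (p + 1)
  strengthIs-order+1 G δ≥1 v (f , strF≤) =
    (f , ≤-antisym strF≤ (order+1≤strF G δ≥1 v f)) , order+1≤strF G δ≥1 v

  -- Ranking by κ, u gets a label at most #{w : κ w ≤ κ u} and v at most p − #{w : κ v < κ w}.
  Fits : ∀ {p} → (Fin p → ℕ) → Fin p → Fin p → Set
  Fits κ u v = countF (λ w → ⌊ κ w ≤? κ u ⌋) ≤ 1 + countF (λ w → ⌊ κ v <? κ w ⌋)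

  key-numbering : ∀ {p} (G : Graph p) (κ : Fin p → ℕ)
    → (∀ u v → adj G u v ≡ true → Fits κ u v ⊎ Fits κ v u) → ∃[ f ] strF G f ≤ p + 1
  key-numbering {p} G κ fits = numbering , strF-lub G numbering edge-sum
    where
    open ByKey κ
    fitting-sum : ∀ u v → Fits κ u v → label numbering u + label numbering v ≤ p + 1
    fitting-sum u v fit = begin
      label numbering u + label numbering v  ≤⟨ +-monoˡ-≤ _ (≤-trans (label≤atOrBelow u) fit) ⟩
      1 + above + label numbering v          ≡⟨ cong suc (+-comm above _) ⟩
      1 + (label numbering v + above)        ≤⟨ s≤s (label+above≤p v) ⟩
      1 + p                                  ≡⟨ +-comm 1 p ⟩
      p + 1                                  ∎
      where
      open ≤-Reasoning
      above = countF (λ w → ⌊ κ v <? κ w ⌋)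
    edge-sum : ∀ u v → adj G u v ≡ true → label numbering u + label numbering v ≤ p + 1
    edge-sum u v e with fits u v e
    ... | inj₁ fit = fitting-sum u v fit
    ... | inj₂ fit = subst (_≤ p + 1) (+-comm (label numbering v) _) (fitting-sum v u fit)

  -- Low and high slots

  data Slot : Set where
    low high : ℕ → Slot

  time : Slot → ℕ
  time (low t) = t
  time (high t) = t

  Compatible : Slot → Slot → Set
  Compatible (low a) (low b) = ⊤
  Compatible (low a) (high b) = a ≤ b
  Compatible (high a) (low b) = b ≤ a
  Compatible (high a) (high b) = ⊥

  lowBy : ℕ → Slot → Bool
  lowBy T (low t) = ⌊ t ≤? T ⌋
  lowBy T (high t) = false

  highBefore : ℕ → Slot → Bool
  highBefore T (low t) = false
  highBefore T (high t) = ⌊ t <? T ⌋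

  lowBy-mono : ∀ {a T} s → a ≤ T → lowBy a s ≡ true → lowBy T s ≡ true
  lowBy-mono (low t) a≤T e = ⌊⌋-true (_ ≤? _) (≤-trans (⌊⌋-sound (_ ≤? _) e) a≤T)

  high-before : ∀ {b s t T} → b ≡ true → s ≡ high t → t < T → b ∧ highBefore T s ≡ true
  high-before refl refl t<T = ⌊⌋-true (_ <? _) t<T

  high-notLow : ∀ {b s t T} → s ≡ high t → b ∧ lowBy T s ≡ false
  high-notLow {b} refl = ∧-zeroʳ b

  data StartsAt (o : ℕ) : Slot → Set where
    low  : ∀ {t} → o < t → StartsAt o (low t)
    high : ∀ {t} → o ≤ t → StartsAt o (high t)

  startsAt-suc : ∀ {o s} → StartsAt (suc o) s → StartsAt o s
  startsAt-suc (low o<t) = low (<⇒≤ o<t)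
  startsAt-suc (high o<t) = high (<⇒≤ o<t)

  compatible-sym : ∀ {a b} → Compatible a b → Compatible b a
  compatible-sym {low _} {low _} _ = tt
  compatible-sym {low _} {high _} a≤b = a≤b
  compatible-sym {high _} {low _} b≤a = b≤a

  startsAt⇒compatible : ∀ {t s} → StartsAt t s → Compatible (low t) s
  startsAt⇒compatible (low _) = tt
  startsAt⇒compatible (high t≤t′) = t≤t′

  startsAt⇒¬lowBy : ∀ {o s T} → StartsAt o s → T ≤ o → lowBy T s ≡ false
  startsAt⇒¬lowBy (low o<t) T≤o = ⌊⌋-false (_ ≤? _) (λ t≤T → <⇒≱ o<t (≤-trans t≤T T≤o))
  startsAt⇒¬lowBy (high _) _ = refl

  module SlotOrder (M : ℕ) where

    B : ℕ
    B = suc M + M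

    key : Slot → ℕ
    key (low t) = t
    key (high t) = B ∸ t

    key-low : ∀ {s a} → s ≡ low a → key s ≡ time s
    key-low refl = refl

    B∸M : B ∸ M ≡ suc M
    B∸M = m+n∸n≡m (suc M) M

    key≤⇒lowBy : ∀ {a} s → time s ≤ M → a ≤ M → key s ≤ a → lowBy a s ≡ true
    key≤⇒lowBy (low t) _ _ t≤a = ⌊⌋-true (t ≤? _) t≤a
    key≤⇒lowBy (high t) t≤M a≤M key≤a = ⊥-elim (<-irrefl refl (begin-strict
      M        <⟨ ≤-refl ⟩
      suc M    ≡⟨ sym B∸M ⟩
      B ∸ M    ≤⟨ ∸-monoʳ-≤ B t≤M ⟩
      B ∸ t    ≤⟨ ≤-trans key≤a a≤M ⟩
      M        ∎))
      where open ≤-Reasoning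

    highBefore⇒key> : ∀ {b} s → b ≤ M → highBefore b s ≡ true → B ∸ b < key s
    highBefore⇒key> (high t) b≤M e = ∸-monoʳ-< (⌊⌋-sound (t <? _) e) (≤-trans b≤M (m≤n+m M (suc M)))

    high⇒key> : ∀ {b} s → time s ≤ M → b ≤ M → highBefore (suc M) s ≡ true → b < key s
    high⇒key> (high t) t≤M b≤M _ = begin-strict
      _        <⟨ s≤s b≤M ⟩
      suc M    ≡⟨ sym B∸M ⟩
      B ∸ M    ≤⟨ ∸-monoʳ-≤ B t≤M ⟩
      B ∸ t    ∎
      where open ≤-Reasoning

  slotted-numbering : ∀ {p} (G : Graph p) (σ : Fin p → Slot) (M : ℕ)
    → (∀ v → time (σ v) ≤ M)
    → (∀ u v → adj G u v ≡ true → Compatible (σ u) (σ v))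
    → (∀ T → countF (λ v → lowBy T (σ v)) ≤ 1 + countF (λ v → highBefore T (σ v)))
    → ∃[ f ] strF G f ≤ p + 1
  slotted-numbering {p} G σ M σ≤M compatible hall = key-numbering G κ edge-fits
    where
    open SlotOrder M
    κ : Fin p → ℕ
    κ v = key (σ v)

    fits-through : ∀ {u v} T → (∀ w → κ w ≤ κ u → lowBy T (σ w) ≡ true)
      → (∀ w → highBefore T (σ w) ≡ true → κ v < κ w) → Fits κ u v
    fits-through T below above = ≤-trans
      (countF-mono (λ w e → below w (⌊⌋-sound (κ w ≤? _) e)))
      (≤-trans (hall T) (s≤s (countF-mono (λ w e → ⌊⌋-true (_ <? κ w) (above w e)))))

    below : ∀ {T} u → κ u ≤ M → κ u ≤ T → ∀ w → κ w ≤ κ u → lowBy T (σ w) ≡ true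
    below u κu≤M κu≤T w κw≤κu = lowBy-mono (σ w) κu≤T (key≤⇒lowBy (σ w) (σ≤M w) κu≤M κw≤κu)

    above-all : ∀ v → κ v ≤ M → ∀ w → highBefore (suc M) (σ w) ≡ true → κ v < κ w
    above-all v κv≤M w = high⇒key> (σ w) (σ≤M w) κv≤M

    above-before : ∀ {b} v → b ≤ M → κ v ≡ B ∸ b → ∀ w → highBefore b (σ w) ≡ true → κ v < κ w
    above-before v b≤M κv≡ w e = subst (_< κ w) (sym κv≡) (highBefore⇒key> (σ w) b≤M e)

    slots-fit : ∀ u v {a b} → σ u ≡ a → σ v ≡ b → Compatible a b → Fits κ u v ⊎ Fits κ v u
    slots-fit u v {low a} {low b} σu σv _ = inj₁ (fits-through (suc M)
      (below u (≤-trans κu≤time (σ≤M u)) (m≤n⇒m≤1+n (≤-trans κu≤time (σ≤M u))))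
      (above-all v (≤-trans (≤-reflexive (key-low σv)) (σ≤M v))))
      where κu≤time = ≤-reflexive (key-low σu)
    slots-fit u v {low a} {high b} σu σv a≤b = inj₁ (fits-through b
      (below u (≤-trans κu≤time (σ≤M u)) (≤-trans (≤-reflexive (cong key σu)) a≤b))
      (above-before v (subst (_≤ M) (cong time σv) (σ≤M v)) (cong key σv)))
      where κu≤time = ≤-reflexive (key-low σu)
    slots-fit u v {high a} {low b} σu σv b≤a = inj₂ (fits-through a
      (below v (≤-trans κv≤time (σ≤M v)) (≤-trans (≤-reflexive (cong key σv)) b≤a))
      (above-before u (subst (_≤ M) (cong time σu) (σ≤M u)) (cong key σu)))
      where κv≤time = ≤-reflexive (key-low σv)

    edge-fits : ∀ u v → adj G u v ≡ true → Fits κ u v ⊎ Fits κ v u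
    edge-fits u v e = slots-fit u v refl refl (compatible u v e)

  -- Slots along a d-sequence

  -- Starting with c spare high slots, step i spends d_i of them and supplies m_i + 1.
  WithinBudget : List (ℕ × ℕ) → ℕ → Set
  WithinBudget [] c = ⊤
  WithinBudget ((m , d) ∷ rest) c = d ≤ c + m × WithinBudget rest (c + m + 1 ∸ d)

  module DSeqSlots {n : ℕ} (H : Graph n) where

    anyF-intro : ∀ {m} (P : Fin m → Bool) i → P i ≡ true → anyF P ≡ true
    anyF-intro P zero e rewrite e = refl
    anyF-intro P (suc i) e with P zero
    ... | true  = refl
    ... | false = anyF-intro (λ j → P (suc j)) i e

    iso⇒¬nbr : ∀ {S v} → isoIn H S v ≡ true → hasNbrIn H S v ≡ false
    iso⇒¬nbr {S} {v} e with S v | hasNbrIn H S v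
    iso⇒¬nbr refl | true | false = refl

    iso⇒no-edge : ∀ {S v w} → isoIn H S v ≡ true → S w ≡ true → adj H v w ≡ true → ⊥
    iso⇒no-edge {S} {v} {w} iso w∈ vw
      with () ← trans (sym (iso⇒¬nbr iso)) (anyF-intro (λ x → S x ∧ adj H v x) w (cong₂ _∧_ w∈ vw))

    nonIso⇒∈ : ∀ {S v} → nonIsoIn H S v ≡ true → S v ≡ true
    nonIso⇒∈ = ∧-conicalˡ _ _

    nonIso⇒¬iso : ∀ {S v} → nonIsoIn H S v ≡ true → isoIn H S v ≡ false
    nonIso⇒¬iso {S} {v} e with S v | hasNbrIn H S v
    nonIso⇒¬iso refl | true | true = refl

    ∉⇒¬iso : ∀ {S v} → S v ≡ false → isoIn H S v ≡ false
    ∉⇒¬iso e rewrite e = refl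

    ∉⇒¬next : ∀ {S u v} → S v ≡ false → nextSet H S u v ≡ false
    ∉⇒¬next e rewrite e = refl

    ∉⇒≢ : ∀ {S : VSet n} {u v} → S u ≡ true → S v ≡ false → ⌊ v ≟ u ⌋ ≡ false
    ∉⇒≢ {u = u} {v} u∈ v∉ = ⌊⌋-false (v ≟ u) λ { refl → true≢false (trans (sym u∈) v∉) }

    ∈∧¬iso⇒nonIso : ∀ {S v} → S v ≡ true → isoIn H S v ≡ false → nonIsoIn H S v ≡ true
    ∈∧¬iso⇒nonIso {S} {v} v∈ ¬iso with S v | hasNbrIn H S v
    ∈∧¬iso⇒nonIso refl refl | true | true = refl

    iso⇒¬nonIso : ∀ {S v} → isoIn H S v ≡ true → nonIsoIn H S v ≡ false
    iso⇒¬nonIso {S} {v} iso rewrite iso⇒¬nbr iso = ∧-zeroʳ (S v)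

    pivot : ∀ {S} → IsIsoPlusClique H S → Fin n
    pivot {S} c = proj₁ (countF-witness (nonIsoIn H S) (≤-trans (s≤s z≤n) (proj₁ c)))

    pivot-nonIso : ∀ {S} (c : IsIsoPlusClique H S) → nonIsoIn H S (pivot c) ≡ true
    pivot-nonIso {S} c = proj₂ (countF-witness (nonIsoIn H S) (≤-trans (s≤s z≤n) (proj₁ c)))

    -- Slots along ℋ_{o+1}, ℋ_{o+2}, …: the isolated vertices of ℋ_{o+1} get high o, u_{o+1} gets
    -- high (o+1) and its neighbours low (o+1); a final clique is treated as a step at its pivot.
    slot : ∀ {S} → DSeq H S → ℕ → Fin n → Slot
    slot (endEmpty _) o v = high o
    slot {S} (endClique c) o v =
      if isoIn H S v then high o
      else if ⌊ v ≟ pivot c ⌋ then high (suc o)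
      else low (suc o)
    slot {S} (step u _ _ D) o v =
      if isoIn H S v then high o
      else if ⌊ v ≟ u ⌋ then high (suc o)
      else if adj H u v then low (suc o)
      else slot D (suc o) v

    horizon : ∀ {S} → DSeq H S → ℕ → ℕ
    horizon (endEmpty _) o = suc o
    horizon (endClique _) o = suc o
    horizon (step _ _ _ D) o = horizon D (suc o)

    o<horizon : ∀ {S} (D : DSeq H S) o → o < horizon D o
    o<horizon (endEmpty _) o = ≤-refl
    o<horizon (endClique _) o = ≤-refl
    o<horizon (step _ _ _ D) o = <-trans (n<1+n o) (o<horizon D (suc o))

    slot≤horizon : ∀ {S} (D : DSeq H S) o v → time (slot D o v) ≤ horizon D o
    slot≤horizon (endEmpty _) o v = n≤1+n o
    slot≤horizon {S} (endClique c) o v with isoIn H S v | ⌊ v ≟ pivot c ⌋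
    ... | true  | _     = n≤1+n o
    ... | false | true  = ≤-refl
    ... | false | false = ≤-refl
    slot≤horizon {S} (step u _ _ D) o v with isoIn H S v | ⌊ v ≟ u ⌋ | adj H u v
    ... | true  | _     | _     = <⇒≤ (<-trans (n<1+n o) (o<horizon D (suc o)))
    ... | false | true  | _     = <⇒≤ (o<horizon D (suc o))
    ... | false | false | true  = <⇒≤ (o<horizon D (suc o))
    ... | false | false | false = slot≤horizon D (suc o) v

    slot-startsAt : ∀ {S} (D : DSeq H S) o v → StartsAt o (slot D o v)
    slot-startsAt (endEmpty _) o v = high ≤-refl
    slot-startsAt {S} (endClique c) o v with isoIn H S v | ⌊ v ≟ pivot c ⌋
    ... | true  | _     = high ≤-refl
    ... | false | true  = high (n≤1+n o)
    ... | false | false = low ≤-refl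
    slot-startsAt {S} (step u _ _ D) o v with isoIn H S v | ⌊ v ≟ u ⌋ | adj H u v
    ... | true  | _     | _     = high ≤-refl
    ... | false | true  | _     = high (n≤1+n o)
    ... | false | false | true  = low ≤-refl
    ... | false | false | false = startsAt-suc (slot-startsAt D (suc o) v)

    lowsBy highsBefore : ∀ {S} → DSeq H S → ℕ → ℕ → ℕ
    lowsBy {S} D o T = countF (λ v → S v ∧ lowBy T (slot D o v))
    highsBefore {S} D o T = countF (λ v → S v ∧ highBefore T (slot D o v))

    no-lows-before : ∀ {S} (D : DSeq H S) {o T} → T ≤ o → lowsBy D o T ≡ 0
    no-lows-before {S} D {o} T≤o = countF-none λ v →
      trans (cong (S v ∧_) (startsAt⇒¬lowBy (slot-startsAt D o v) T≤o)) (∧-zeroʳ (S v))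

    module Step {S} (u : Fin n) (u∈ : nonIsoIn H S u ≡ true) (¬end : ¬ Terminal H S)
                (D : DSeq H (nextSet H S u)) (o : ℕ) where

      σ : Fin n → Slot
      σ = slot (step u u∈ ¬end D) o

      data Role : Fin n → Set where
        isolated  : ∀ {v} → S v ≡ true → isoIn H S v ≡ true → nextSet H S u v ≡ false
                  → σ v ≡ high o → Role v
        chosen    : isoIn H S u ≡ false → nextSet H S u u ≡ false → σ u ≡ high (suc o) → Role u
        neighbour : ∀ {v} → S v ≡ true → isoIn H S v ≡ false → ⌊ v ≟ u ⌋ ≡ false → adj H u v ≡ true
                  → nextSet H S u v ≡ false → σ v ≡ low (suc o) → Role v
        later     : ∀ {v} → S v ≡ true → isoIn H S v ≡ false → ⌊ v ≟ u ⌋ ≡ false → adj H u v ≡ false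
                  → nextSet H S u v ≡ true → σ v ≡ slot D (suc o) v → Role v
        outside   : ∀ {v} → S v ≡ false → isoIn H S v ≡ false → ⌊ v ≟ u ⌋ ≡ false
                  → nextSet H S u v ≡ false → Role v

      role : ∀ v → Role v
      role v with S v in v∈
      ... | false =
        outside v∈ (∉⇒¬iso {S} {v} v∈) (∉⇒≢ (nonIso⇒∈ u∈) v∈) (∉⇒¬next {S} {u} {v} v∈)
      ... | true with isoIn H S v in iso
      ...   | true = isolated v∈ iso ¬next σ-iso
        where
        ¬next : nextSet H S u v ≡ false
        ¬next rewrite iso⇒¬nonIso {S} {v} iso = refl
        σ-iso : σ v ≡ high o
        σ-iso rewrite iso = refl
      ...   | false with nonIso ← ∈∧¬iso⇒nonIso {S} {v} v∈ iso | v ≟ u | adj H u v in uv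
      ...     | yes refl | _ = chosen iso ¬next σ-chosen
        where
        ¬next : nextSet H S u u ≡ false
        ¬next rewrite ⌊⌋-true (u ≟ u) refl = ∧-zeroʳ _
        σ-chosen : σ u ≡ high (suc o)
        σ-chosen rewrite iso | ⌊⌋-true (u ≟ u) refl = refl
      ...     | no v≢u | true = neighbour v∈ iso (⌊⌋-false (v ≟ u) v≢u) uv ¬next σ-neighbour
        where
        ¬next : nextSet H S u v ≡ false
        ¬next rewrite nonIso | ⌊⌋-false (v ≟ u) v≢u | uv = refl
        σ-neighbour : σ v ≡ low (suc o)
        σ-neighbour rewrite iso | ⌊⌋-false (v ≟ u) v≢u | uv = refl
      ...     | no v≢u | false = later v∈ iso (⌊⌋-false (v ≟ u) v≢u) uv next σ-later
        where
        next : nextSet H S u v ≡ true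
        next rewrite nonIso | ⌊⌋-false (v ≟ u) v≢u | uv = refl
        σ-later : σ v ≡ slot D (suc o) v
        σ-later rewrite iso | ⌊⌋-false (v ≟ u) v≢u | uv = refl

      lowsIn highsIn lowsNext highsNext : ℕ → Fin n → Bool
      lowsIn T v = S v ∧ lowBy T (σ v)
      highsIn T v = S v ∧ highBefore T (σ v)
      lowsNext T v = nextSet H S u v ∧ lowBy T (slot D (suc o) v)
      highsNext T v = nextSet H S u v ∧ highBefore T (slot D (suc o) v)

      private
        lows-split-by : ∀ T v {x y z} → lowsIn T v ≡ x → S v ∧ adj H u v ≡ y → lowsNext T v ≡ z
          → indicator x ≤ indicator y + indicator z
          → indicator (lowsIn T v) ≤ indicator (S v ∧ adj H u v) + indicator (lowsNext T v)
        lows-split-by T v = indicator-≤-+-by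

        highs-split-by : ∀ T v {x y z}
          → isoIn H S v ∨ ⌊ v ≟ u ⌋ ≡ x → highsNext T v ≡ y → highsIn T v ≡ z
          → indicator x + indicator y ≤ indicator z
          → indicator (isoIn H S v ∨ ⌊ v ≟ u ⌋) + indicator (highsNext T v) ≤ indicator (highsIn T v)
        highs-split-by T v = indicator-+-≤-by

      lows-split : ∀ T v → indicator (lowsIn T v) ≤ indicator (S v ∧ adj H u v) + indicator (lowsNext T v)
      lows-split T v with role v
      ... | isolated _ _ _ σv = lows-split-by T v (high-notLow σv) refl refl z≤n
      ... | chosen _ _ σv = lows-split-by T v (high-notLow σv) refl refl z≤n
      ... | neighbour v∈ _ _ uv _ _ =
        lows-split-by T v refl (cong₂ _∧_ v∈ uv) refl (≤-trans (indicator≤1 _) (m≤m+n 1 _))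
      ... | later v∈ _ _ ¬uv next σv =
        lows-split-by T v (cong₂ (λ b s → b ∧ lowBy T s) v∈ σv) (trans (cong (S v ∧_) ¬uv) (∧-zeroʳ (S v)))
           (cong (_∧ lowBy T (slot D (suc o) v)) next) ≤-refl
      ... | outside v∉ _ _ _ = lows-split-by T v (cong (_∧ lowBy T (σ v)) v∉) refl refl z≤n

      isolated-or-chosen : ∀ v → indicator (isoIn H S v) + indicator ⌊ v ≟ u ⌋
        ≤ indicator (isoIn H S v ∨ ⌊ v ≟ u ⌋)
      isolated-or-chosen v with v ≟ u
      ... | yes refl rewrite nonIso⇒¬iso u∈ = ≤-refl
      ... | no _ rewrite ∨-identityʳ (isoIn H S v) = ≤-reflexive (+-identityʳ _)

      highs-split : ∀ {T} → suc o < T → ∀ v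
        → indicator (isoIn H S v ∨ ⌊ v ≟ u ⌋) + indicator (highsNext T v) ≤ indicator (highsIn T v)
      highs-split {T} o+1<T v with role v
      ... | isolated v∈ iso ¬next σv =
        highs-split-by T v (cong (_∨ ⌊ v ≟ u ⌋) iso) (cong (_∧ highBefore T (slot D (suc o) v)) ¬next)
           (high-before v∈ σv (<-trans (n<1+n o) o+1<T)) ≤-refl
      ... | chosen iso ¬next σv =
        highs-split-by T v (cong₂ _∨_ iso (⌊⌋-true (u ≟ u) refl))
           (cong (_∧ highBefore T (slot D (suc o) u)) ¬next)
           (high-before (nonIso⇒∈ u∈) σv o+1<T) ≤-refl
      ... | neighbour _ iso v≢u _ ¬next _ =
        highs-split-by T v (cong₂ _∨_ iso v≢u) (cong (_∧ highBefore T (slot D (suc o) v)) ¬next) refl z≤n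
      ... | later v∈ iso v≢u _ next σv =
        highs-split-by T v (cong₂ _∨_ iso v≢u) (cong (_∧ highBefore T (slot D (suc o) v)) next)
           (cong₂ (λ b s → b ∧ highBefore T s) v∈ σv) ≤-refl
      ... | outside _ iso v≢u ¬next =
        highs-split-by T v (cong₂ _∨_ iso v≢u) (cong (_∧ highBefore T (slot D (suc o) v)) ¬next) refl z≤n

      isolated-high : ∀ {T} → o < T → ∀ v → isoIn H S v ≡ true → highsIn T v ≡ true
      isolated-high o<T v iso with role v
      ... | isolated v∈ _ _ σv = high-before v∈ σv o<T
      ... | chosen ¬iso _ _ = ⊥-elim (true≢false (trans (sym iso) ¬iso))
      ... | neighbour _ ¬iso _ _ _ _ = ⊥-elim (true≢false (trans (sym iso) ¬iso))
      ... | later _ ¬iso _ _ _ _ = ⊥-elim (true≢false (trans (sym iso) ¬iso))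
      ... | outside _ ¬iso _ _ = ⊥-elim (true≢false (trans (sym iso) ¬iso))

      slot-count : ∀ {c} → degIn H S u ≤ c + countF (isoIn H S)
        → (∀ T → lowsBy D (suc o) T ≤ (c + countF (isoIn H S) + 1 ∸ degIn H S u) + highsBefore D (suc o) T)
        → ∀ T → lowsBy (step u u∈ ¬end D) o T ≤ c + highsBefore (step u u∈ ¬end D) o T
      slot-count {c} d≤c+m later-count T with <-cmp T (suc o)
      ... | tri< T<o+1 _ _ = ≤-trans (≤-reflexive (no-lows-before (step u u∈ ¬end D) (≤-pred T<o+1))) z≤n
      ... | tri≈ _ refl _ = begin
        lowsBy (step u u∈ ¬end D) o (suc o)     ≤⟨ countF-≤-+ (lows-split (suc o)) ⟩
        degIn H S u + lowsBy D (suc o) (suc o)  ≡⟨ cong (degIn H S u +_) (no-lows-before D ≤-refl) ⟩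
        degIn H S u + 0                         ≤⟨ ≤-trans (≤-reflexive (+-identityʳ _)) d≤c+m ⟩
        c + m                                   ≤⟨ +-monoʳ-≤ c (countF-mono (isolated-high ≤-refl)) ⟩
        c + highsBefore (step u u∈ ¬end D) o (suc o) ∎
        where
        open ≤-Reasoning
        m = countF (isoIn H S)
      ... | tri> _ _ o+1<T = begin
        lowsBy (step u u∈ ¬end D) o T           ≤⟨ countF-≤-+ (lows-split T) ⟩
        d + lowsBy D (suc o) T                  ≤⟨ +-monoʳ-≤ d (later-count T) ⟩
        d + (c′ + highsBefore D (suc o) T)      ≡⟨ sym (+-assoc d c′ _) ⟩
        d + c′ + highsBefore D (suc o) T        ≡⟨ cong (_+ highsBefore D (suc o) T) d+c′≡c+m+1 ⟩
        c + m + 1 + highsBefore D (suc o) T     ≡⟨ cong (_+ highsBefore D (suc o) T) (+-assoc c m 1) ⟩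
        c + (m + 1) + highsBefore D (suc o) T   ≡⟨ +-assoc c (m + 1) (highsBefore D (suc o) T) ⟩
        c + (m + 1 + highsBefore D (suc o) T)   ≤⟨ +-monoʳ-≤ c (+-monoˡ-≤ _ m+1≤iso∨u) ⟩
        c + (countF (λ v → isoIn H S v ∨ ⌊ v ≟ u ⌋) + highsBefore D (suc o) T)
                                                ≤⟨ +-monoʳ-≤ c (countF-+-≤ (highs-split o+1<T)) ⟩
        c + highsBefore (step u u∈ ¬end D) o T  ∎
        where
        open ≤-Reasoning
        d = degIn H S u
        m = countF (isoIn H S)
        c′ = c + m + 1 ∸ d
        d+c′≡c+m+1 : d + c′ ≡ c + m + 1
        d+c′≡c+m+1 = m+[n∸m]≡n (≤-trans d≤c+m (m≤m+n (c + m) 1))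
        m+1≤iso∨u : m + 1 ≤ countF (λ v → isoIn H S v ∨ ⌊ v ≟ u ⌋)
        m+1≤iso∨u = ≤-trans (+-monoʳ-≤ m (countF-pos (λ v → ⌊ v ≟ u ⌋) u (⌊⌋-true (u ≟ u) refl)))
                            (countF-+-≤ isolated-or-chosen)

    module Clique {S} (c : IsIsoPlusClique H S) (o : ℕ) where

      σ : Fin n → Slot
      σ = slot (endClique c) o

      data Role : Fin n → Set where
        isolated : ∀ {v} → S v ≡ true → isoIn H S v ≡ true → ⌊ v ≟ pivot c ⌋ ≡ false
                 → σ v ≡ high o → Role v
        chosen   : σ (pivot c) ≡ high (suc o) → Role (pivot c)
        member   : ∀ {v} → nonIsoIn H S v ≡ true → ⌊ v ≟ pivot c ⌋ ≡ false
                 → σ v ≡ low (suc o) → Role v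
        outside  : ∀ {v} → S v ≡ false → ⌊ v ≟ pivot c ⌋ ≡ false → Role v

      role : ∀ v → Role v
      role v with S v in v∈
      ... | false = outside v∈ (∉⇒≢ (nonIso⇒∈ (pivot-nonIso c)) v∈)
      ... | true with isoIn H S v in iso
      ...   | true = isolated v∈ iso v≢p σ-iso
        where
        v≢p = ⌊⌋-false (v ≟ pivot c)
                λ { refl → true≢false (trans (sym iso) (nonIso⇒¬iso (pivot-nonIso c))) }
        σ-iso : σ v ≡ high o
        σ-iso rewrite iso = refl
      ...   | false with v ≟ pivot c
      ...     | yes refl = chosen σ-chosen
        where
        σ-chosen : σ v ≡ high (suc o)
        σ-chosen rewrite iso | ⌊⌋-true (v ≟ v) refl = refl
      ...     | no v≢p = member (∈∧¬iso⇒nonIso {S} {v} v∈ iso) (⌊⌋-false (v ≟ pivot c) v≢p) σ-member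
        where
        σ-member : σ v ≡ low (suc o)
        σ-member rewrite iso | ⌊⌋-false (v ≟ pivot c) v≢p = refl

      private
        lows-and-pivot-by : ∀ T v {x y z} → S v ∧ lowBy T (σ v) ≡ x → ⌊ v ≟ pivot c ⌋ ≡ y
          → nonIsoIn H S v ≡ z → indicator x + indicator y ≤ indicator z
          → indicator (S v ∧ lowBy T (σ v)) + indicator ⌊ v ≟ pivot c ⌋ ≤ indicator (nonIsoIn H S v)
        lows-and-pivot-by T v = indicator-+-≤-by

      lows-and-pivot : ∀ T v → indicator (S v ∧ lowBy T (σ v)) + indicator ⌊ v ≟ pivot c ⌋
        ≤ indicator (nonIsoIn H S v)
      lows-and-pivot T v with role v
      ... | isolated _ _ v≢p σv = lows-and-pivot-by T v (high-notLow σv) v≢p refl z≤n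
      ... | chosen σv =
        lows-and-pivot-by T v (high-notLow σv) (⌊⌋-true (pivot c ≟ pivot c) refl) (pivot-nonIso c) ≤-refl
      ... | member nonIso v≢p _ =
        lows-and-pivot-by T v refl v≢p nonIso (≤-trans (≤-reflexive (+-identityʳ _)) (indicator≤1 _))
      ... | outside v∉ v≢p = lows-and-pivot-by T v (cong (_∧ lowBy T (σ v)) v∉) v≢p refl z≤n

      isolated-high : ∀ {T} → o < T → ∀ v → isoIn H S v ≡ true → S v ∧ highBefore T (σ v) ≡ true
      isolated-high o<T v iso with role v
      ... | isolated v∈ _ _ σv = high-before v∈ σv o<T
      ... | chosen _ = ⊥-elim (true≢false (trans (sym iso) (nonIso⇒¬iso (pivot-nonIso c))))
      ... | member nonIso _ _ = ⊥-elim (true≢false (trans (sym iso) (nonIso⇒¬iso nonIso)))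
      ... | outside v∉ _ = ⊥-elim (true≢false (trans (sym (∧-conicalˡ _ _ iso)) v∉))

      slot-count : ∀ {b} → countF (nonIsoIn H S) ∸ 1 ≤ b + countF (isoIn H S) → ∀ T
        → lowsBy (endClique c) o T ≤ b + highsBefore (endClique c) o T
      slot-count {b} d≤b+m T with T ≤? o
      ... | yes T≤o = ≤-trans (≤-reflexive (no-lows-before (endClique c) T≤o)) z≤n
      ... | no T≰o = begin
        lowsBy (endClique c) o T               ≤⟨ m+n≤o⇒m≤o∸n _ lows+1≤nonIso ⟩
        countF (nonIsoIn H S) ∸ 1              ≤⟨ d≤b+m ⟩
        b + countF (isoIn H S)                 ≤⟨ +-monoʳ-≤ b (countF-mono (isolated-high (≰⇒> T≰o))) ⟩
        b + highsBefore (endClique c) o T      ∎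
        where
        open ≤-Reasoning
        lows+1≤nonIso : lowsBy (endClique c) o T + 1 ≤ countF (nonIsoIn H S)
        lows+1≤nonIso = ≤-trans
          (+-monoʳ-≤ _ (countF-pos (λ v → ⌊ v ≟ pivot c ⌋) (pivot c) (⌊⌋-true (pivot c ≟ pivot c) refl)))
          (countF-+-≤ (lows-and-pivot T))

    open Step using (isolated; chosen; neighbour; later; outside)
    open Clique using (isolated; chosen; member; outside)

    slot-compatible : ∀ {S} (D : DSeq H S) o {v w} → S v ≡ true → S w ≡ true → adj H v w ≡ true
      → Compatible (slot D o v) (slot D o w)
    slot-compatible (endEmpty (_ , edgeless)) o v∈ w∈ vw with () ← trans (sym vw) (edgeless _ _ v∈ w∈)
    slot-compatible (endClique c) o {v} {w} v∈ w∈ vw with Clique.role c o v | Clique.role c o w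
    ... | outside v∉ _ | _ with () ← trans (sym v∈) v∉
    ... | _ | outside w∉ _ with () ← trans (sym w∈) w∉
    ... | isolated _ iso _ _ | _ = ⊥-elim (iso⇒no-edge iso w∈ vw)
    ... | _ | isolated _ iso _ _ = ⊥-elim (iso⇒no-edge iso v∈ (trans (adj-sym H w v) vw))
    ... | chosen _ | chosen _ with () ← trans (sym vw) (irrefl H v)
    ... | chosen σv | member _ _ σw = subst₂ Compatible (sym σv) (sym σw) ≤-refl
    ... | member _ _ σv | chosen σw = subst₂ Compatible (sym σv) (sym σw) ≤-refl
    ... | member _ _ σv | member _ _ σw = subst₂ Compatible (sym σv) (sym σw) tt
    slot-compatible (step u u∈ ¬end D) o {v} {w} v∈ w∈ vw
      with Step.role u u∈ ¬end D o v | Step.role u u∈ ¬end D o w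
    ... | outside v∉ _ _ _ | _ with () ← trans (sym v∈) v∉
    ... | _ | outside w∉ _ _ _ with () ← trans (sym w∈) w∉
    ... | isolated _ iso _ _ | _ = ⊥-elim (iso⇒no-edge iso w∈ vw)
    ... | _ | isolated _ iso _ _ = ⊥-elim (iso⇒no-edge iso v∈ (trans (adj-sym H w v) vw))
    ... | chosen _ _ _ | chosen _ _ _ with () ← trans (sym vw) (irrefl H v)
    ... | chosen _ _ _ | later _ _ _ ¬uw _ _ with () ← trans (sym vw) ¬uw
    ... | later _ _ _ ¬uv _ _ | chosen _ _ _ with () ← trans (sym vw) (trans (adj-sym H v w) ¬uv)
    ... | chosen _ _ σv | neighbour _ _ _ _ _ σw = subst₂ Compatible (sym σv) (sym σw) ≤-refl
    ... | neighbour _ _ _ _ _ σv | chosen _ _ σw = subst₂ Compatible (sym σv) (sym σw) ≤-refl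
    ... | neighbour _ _ _ _ _ σv | neighbour _ _ _ _ _ σw = subst₂ Compatible (sym σv) (sym σw) tt
    ... | neighbour _ _ _ _ _ σv | later _ _ _ _ _ σw =
      subst₂ Compatible (sym σv) (sym σw) (startsAt⇒compatible (slot-startsAt D (suc o) w))
    ... | later _ _ _ _ _ σv | neighbour _ _ _ _ _ σw =
      subst₂ Compatible (sym σv) (sym σw) (compatible-sym (startsAt⇒compatible (slot-startsAt D (suc o) v)))
    ... | later _ _ _ _ v′ σv | later _ _ _ _ w′ σw =
      subst₂ Compatible (sym σv) (sym σw) (slot-compatible D (suc o) v′ w′ vw)

    slot-count : ∀ {S} (D : DSeq H S) o {c} → WithinBudget (params H D) c → ∀ T
      → lowsBy D o T ≤ c + highsBefore D o T
    slot-count {S} (endEmpty _) o _ T =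
      ≤-trans (≤-reflexive (countF-none (λ v → ∧-zeroʳ (S v)))) z≤n
    slot-count (endClique cl) o (d≤c+m , _) T = Clique.slot-count cl o d≤c+m T
    slot-count (step u u∈ ¬end D) o (d≤c+m , rest) T =
      Step.slot-count u u∈ ¬end D o d≤c+m (slot-count D (suc o) rest) T

  dFirst-pos : ∀ {n} (H : Graph n) → MinDegPos H → (D : DSeq H fullSet) → 1 ≤ dFirst H D
  dFirst-pos H δ≥1 (endEmpty ((v , _) , edgeless))
    with () ← trans (sym (proj₂ (δ≥1 v))) (edgeless v (proj₁ (δ≥1 v)) refl refl)
  dFirst-pos H δ≥1 (endClique (2≤r , _)) = m+n≤o⇒m≤o∸n 1 2≤r
  dFirst-pos H δ≥1 (step u _ _ _) = countF-pos _ (proj₁ (δ≥1 u)) (proj₂ (δ≥1 u))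

  -- The union with a star

  countF-splitAt-⊎ : ∀ m {n} (P : Fin m ⊎ Fin n → Bool)
    → countF (λ v → P (splitAt m v)) ≡ countF (λ i → P (inj₁ i)) + countF (λ j → P (inj₂ j))
  countF-splitAt-⊎ m {n} P = trans (countF-splitAt m _) (cong₂ _+_
    (countF-cong (λ i → cong P (Fin.splitAt-↑ˡ m i n)))
    (countF-cong (λ j → cong P (Fin.splitAt-↑ʳ m n j))))

  minDegPos-⊕ : ∀ {m n} {G : Graph m} {H : Graph n} → MinDegPos G → MinDegPos H → MinDegPos (G ⊕ H)
  minDegPos-⊕ {m} {n} {G} {H} δG δH v with splitAt m v
  ... | inj₁ x = proj₁ (δG x) ↑ˡ n , trans (cong (sumAdj G H (inj₁ x)) (Fin.splitAt-↑ˡ m _ n)) (proj₂ (δG x))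
  ... | inj₂ y = m ↑ʳ proj₁ (δH y) , trans (cong (sumAdj G H (inj₂ y)) (Fin.splitAt-↑ʳ m n _)) (proj₂ (δH y))

  minDegPos-star : ∀ {k} → 1 ≤ k → MinDegPos (star k)
  minDegPos-star {suc k} _ zero = suc zero , refl
  minDegPos-star _ (suc _) = zero , refl

  starSlot : ∀ {k} → Fin (suc k) → Slot
  starSlot zero = low 0
  starSlot (suc _) = high 0

  star-lows≤1 : ∀ {k} T → countF (λ j → lowBy T (starSlot {k} j)) ≤ 1
  star-lows≤1 {k} T = begin
    centre + countF {k} (λ _ → false)  ≡⟨ cong (centre +_) (countF-none {k} (λ _ → refl)) ⟩
    centre + 0                         ≡⟨ +-identityʳ centre ⟩
    centre                             ≤⟨ indicator≤1 _ ⟩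
    1                                  ∎
    where
    open ≤-Reasoning
    centre = indicator (lowBy T (low 0))

  star-highs : ∀ {k} t → countF (λ j → highBefore (suc t) (starSlot {k} j)) ≡ k
  star-highs t = countF-all (λ _ → refl)

  module StarUnion {n} (H : Graph n) (D : DSeq H fullSet) (k : ℕ)
                   (budget : WithinBudget (params H D) k) where
    open DSeqSlots H

    σ⊎ : Fin n ⊎ Fin (suc k) → Slot
    σ⊎ = [ slot D 0 , starSlot ]′

    σ : Fin (n + suc k) → Slot
    σ v = σ⊎ (splitAt n v)

    lows-split : ∀ T → countF (λ v → lowBy T (σ v))
      ≡ lowsBy D 0 T + countF (λ j → lowBy T (starSlot {k} j))
    lows-split T = countF-splitAt-⊎ n (λ s → lowBy T (σ⊎ s))

    highs-split : ∀ T → countF (λ v → highBefore T (σ v))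
      ≡ highsBefore D 0 T + countF (λ j → highBefore T (starSlot {k} j))
    highs-split T = countF-splitAt-⊎ n (λ s → highBefore T (σ⊎ s))

    σ≤horizon : ∀ v → time (σ v) ≤ horizon D 0
    σ≤horizon v with splitAt n v
    ... | inj₁ x = slot≤horizon D 0 x
    ... | inj₂ zero = z≤n
    ... | inj₂ (suc _) = z≤n

    σ-compatible : ∀ v w → adj (H ⊕ star k) v w ≡ true → Compatible (σ v) (σ w)
    σ-compatible v w vw with splitAt n v | splitAt n w
    ... | inj₁ x | inj₁ y = slot-compatible D 0 refl refl vw
    ... | inj₂ zero | inj₂ (suc _) = z≤n
    ... | inj₂ (suc _) | inj₂ zero = z≤n

    σ-hall : ∀ T → countF (λ v → lowBy T (σ v)) ≤ 1 + countF (λ v → highBefore T (σ v))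
    σ-hall zero = begin
      countF (λ v → lowBy 0 (σ v))   ≡⟨ lows-split 0 ⟩
      lowsBy D 0 0 + _               ≤⟨ +-mono-≤ (≤-reflexive (no-lows-before D z≤n)) (star-lows≤1 {k} 0) ⟩
      1                              ≤⟨ m≤m+n 1 _ ⟩
      1 + _                          ∎
      where open ≤-Reasoning
    σ-hall (suc t) = begin
      countF (λ v → lowBy (suc t) (σ v))  ≡⟨ lows-split (suc t) ⟩
      lowsBy D 0 (suc t) + _              ≤⟨ +-mono-≤ (slot-count D 0 budget (suc t)) (star-lows≤1 {k} (suc t)) ⟩
      k + highs + 1                       ≡⟨ +-comm (k + highs) 1 ⟩
      1 + (k + highs)                     ≡⟨ cong (1 +_) (+-comm k highs) ⟩
      1 + (highs + k)                     ≡⟨ cong (λ x → 1 + (highs + x)) (sym (star-highs {k} t)) ⟩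
      1 + (highs + _)                     ≡⟨ cong (1 +_) (sym (highs-split (suc t))) ⟩
      1 + countF (λ v → highBefore (suc t) (σ v)) ∎
      where
      open ≤-Reasoning
      highs = highsBefore D 0 (suc t)

  strength-⊕-star : ∀ {n} (H : Graph n) → MinDegPos H → (D : DSeq H fullSet) (k : ℕ)
    → dFirst H D ≤ k → WithinBudget (params H D) k → StrengthIs (H ⊕ star k) (n + suc k + 1)
  strength-⊕-star {n} H δ≥1 D k d≤k budget =
    strengthIs-order+1 (H ⊕ star k) (minDegPos-⊕ δ≥1 (minDegPos-star (≤-trans (dFirst-pos H δ≥1 D) d≤k)))
      (n ↑ʳ zero) (slotted-numbering (H ⊕ star k) σ (horizon D 0) σ≤horizon σ-compatible σ-hall)
    where
    open StarUnion H D k budget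
    open DSeqSlots H using (horizon)

module Budget where

  open import Data.Nat as ℕ using (_∸_)
  import Data.Nat.Properties as ℕ
  open import Data.Integer using (+_; 0ℤ; 1ℤ; _+_; _-_; _≤_; +≤+)
  open import Data.Integer.Properties
  open import Data.Integer.Tactic.RingSolver using (solve-∀)
  open import Data.Product using (_×_; _,_)
  open import Data.List using ([]; _∷_; map)
  open import Data.List.Relation.Unary.All as All using (All; []; _∷_)
  open import Data.Maybe using (just; nothing)
  open import Relation.Binary.PropositionalEquality
  open Strength using (WithinBudget)

  ≤-by-difference : ∀ {i j i′ j′} → i ≤ j → j - i ≡ j′ - i′ → i′ ≤ j′
  ≤-by-difference i≤j eq = 0≤i-j⇒j≤i (subst (0ℤ ≤_) eq (i≤j⇒0≤j-i i≤j))

  minList-nothing : ∀ xs → minList xs ≡ nothing → xs ≡ []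
  minList-nothing [] _ = refl
  minList-nothing (x ∷ xs) e with minList xs
  minList-nothing (x ∷ xs) () | nothing
  minList-nothing (x ∷ xs) () | just _

  minList-lowerBound : ∀ xs {Z} → minList xs ≡ just Z → All (Z ≤_) xs
  minList-lowerBound (x ∷ xs) e with minList xs in eq
  minList-lowerBound (x ∷ xs) refl | nothing rewrite minList-nothing xs eq = ≤-refl ∷ []
  minList-lowerBound (x ∷ xs) refl | just m =
    i⊓j≤i x m ∷ All.map (≤-trans (i⊓j≤j x m)) (minList-lowerBound xs eq)

  pos-∸ : ∀ {m d} → d ℕ.≤ m → + (m ∸ d) ≡ + m - + d
  pos-∸ {m} {d} d≤m = trans (sym (⊖-≥ d≤m)) (sym (m-n≡m⊖n m d))

  budget-spent : ∀ c m d → 1ℤ ≤ + c + yOf (m , d) → d ℕ.≤ c ℕ.+ m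
  budget-spent c m d 1≤c+y = drop‿+≤+ (≤-by-difference 1≤c+y
    (trans (difference (+ c) (+ m) (+ d)) (cong (_- + d) (sym (pos-+ c m)))))
    where
    difference : ∀ c m d → c + ((m + 1ℤ) - d) - 1ℤ ≡ (c + m) - d
    difference = solve-∀

  budget-update : ∀ c m d → d ℕ.≤ c ℕ.+ m → + (c ℕ.+ m ℕ.+ 1 ∸ d) ≡ + c + yOf (m , d)
  budget-update c m d d≤c+m = begin
    + (c ℕ.+ m ℕ.+ 1 ∸ d)   ≡⟨ pos-∸ (ℕ.≤-trans d≤c+m (ℕ.m≤m+n (c ℕ.+ m) 1)) ⟩
    + (c ℕ.+ m ℕ.+ 1) - + d ≡⟨ cong (_- + d) (trans (pos-+ (c ℕ.+ m) 1) (cong (_+ 1ℤ) (pos-+ c m))) ⟩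
    + c + + m + 1ℤ - + d    ≡⟨ regroup (+ c) (+ m) (+ d) ⟩
    + c + yOf (m , d)       ∎
    where
    open ≡-Reasoning
    regroup : ∀ c m d → c + m + 1ℤ - d ≡ c + ((m + 1ℤ) - d)
    regroup = solve-∀

  -- Generalised over the starting value a of the prefix sums, which moves along the recursion.
  prefixSums-budget : ∀ xs a c → All (λ z → a + 1ℤ ≤ + c + z) (prefixSums a (map yOf xs))
    → WithinBudget xs c
  prefixSums-budget [] a c _ = _
  prefixSums-budget ((m , d) ∷ xs) a c (first ∷ rest) =
    d≤c+m , prefixSums-budget xs (a + y) (c ℕ.+ m ℕ.+ 1 ∸ d) (All.map (λ {z} → shift {z}) rest)
    where
    y = yOf (m , d)
    d≤c+m : d ℕ.≤ c ℕ.+ m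
    d≤c+m = budget-spent c m d (≤-by-difference first (cancel-a a (+ c) y))
      where
      cancel-a : ∀ a c y → c + (a + y) - (a + 1ℤ) ≡ c + y - 1ℤ
      cancel-a = solve-∀
    shift : ∀ {z} → a + 1ℤ ≤ + c + z → a + y + 1ℤ ≤ + (c ℕ.+ m ℕ.+ 1 ∸ d) + z
    shift {z} a+1≤c+z rewrite budget-update c m d d≤c+m = ≤-by-difference a+1≤c+z (same a (+ c) y z)
      where
      same : ∀ a c y z → c + z - (a + 1ℤ) ≡ c + y + z - (a + y + 1ℤ)
      same = solve-∀

  zmin-budget : ∀ {n} (H : Graph n) (D : DSeq H fullSet) {Z} → Zmin H D ≡ just Z → Z ≤ 0ℤ
    → ∀ k → + dFirst H D - Z ≤ + k → dFirst H D ℕ.≤ k × WithinBudget (params H D) k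
  zmin-budget H (endEmpty _) ()
  zmin-budget H (endClique _) ()
  zmin-budget H (step u u∈ ¬end D) {Z} Zmin≡Z Z≤0 k d-Z≤k =
    d≤k , ℕ.≤-trans d≤k (ℕ.m≤m+n k m) ,
    prefixSums-budget (params H D) 0ℤ (k ℕ.+ m ℕ.+ 1 ∸ d) (All.map (λ {z} → later-positive {z}) Z≤zs)
    where
    d = dFirst H (step u u∈ ¬end D)
    m = countF (isoIn H fullSet)
    d≤d-Z : + d ≤ + d - Z
    d≤d-Z = ≤-trans (≤-reflexive (sym (+-identityʳ (+ d)))) (+-monoʳ-≤ (+ d) (neg-mono-≤ Z≤0))
    d≤k : d ℕ.≤ k
    d≤k = drop‿+≤+ (≤-trans d≤d-Z d-Z≤k)
    Z≤zs : All (Z ≤_) (zList H (step u u∈ ¬end D))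
    Z≤zs = minList-lowerBound _ Zmin≡Z
    later-positive : ∀ {z} → Z ≤ z → 0ℤ + 1ℤ ≤ + (k ℕ.+ m ℕ.+ 1 ∸ d) + z
    later-positive {z} Z≤z rewrite budget-update k m d (ℕ.≤-trans d≤k (ℕ.m≤m+n k m)) =
      ≤-by-difference (+-mono-≤ (+-mono-≤ d-Z≤k Z≤z) (+≤+ ℕ.z≤n)) (same (+ k) (+ m) (+ d) Z z)
      where
      same : ∀ k m d Z z → k + z + m - (d - Z + Z + 0ℤ) ≡ k + ((m + 1ℤ) - d) + z - (0ℤ + 1ℤ)
      same = solve-∀

open import Data.Nat using (ℕ; suc; _+_)
open import Data.Maybe using (just)
open import Data.Integer using (ℤ; +_; _-_; _≤_)
open import Relation.Binary.PropositionalEquality using (_≡_)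
open import Data.Product using (_,_)

mainTheorem16 : ∀ {n} (H : Graph n) → MinDegPos H
    → (D : DSeq H fullSet) (Z : ℤ) → Zmin H D ≡ just Z → Z ≤ + 0
    → (k : ℕ) → (+ dFirst H D) - Z ≤ + k
    → StrengthIs (H ⊕ star k) ((n + suc k) + 1)
mainTheorem16 H δ≥1 D Z Zmin≡Z Z≤0 k d-Z≤k =
  let d≤k , budget = Budget.zmin-budget H D Zmin≡Z Z≤0 k d-Z≤k
  in Strength.strength-⊕-star H δ≥1 D k d≤k budget
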